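{- Let $N\ge2$ and consider the weighted game of best choice on $\mathfrak{S}_N$ with the Ewens weighting, and let $\kappa_N(\theta)$ be the number of initial rejections in the optimal positional strategy for parameter $\theta>0$. Then $$\kappa_N(\theta)=\begin{cases}0 & \text{if } 0<\theta\le\big(\sum_{i=1}^{N-1}\frac1i\big)^{ -1},\\ k & \text{if } \big(\sum_{i=k}^{N-1}\frac1i\big)^{ -1}<\theta\le\big(\sum_{i=k+1}^{N-1}\frac1i\big)^{ -1},\ 1\le k\le N-2,\\ N-1 & \text{if } \theta>N-1.\end{cases}$$
   Context: The Ewens-weighted game of best choice picks $\pi\in\mathfrak{S}_N$ with probability proportional to $\theta^{\mathrm{lrm}(\pi)}$, where $\mathrm{lrm}(\pi)$ is the number of left-to-right maxima of $\pi$ (entries larger than all entries to their left); $\pi_i$ is the rank of candidate $i$ ($N$ best); the interviewer sees candidates sequentially, observing only relative ranks of those seen so far, and must accept or irrevocably reject each; the game is won if the accepted candidate has rank $N$. For this game some positional strategy (reject the first $k$ candidates, then accept the first subsequent candidate better than all previous ones) is optimal, and $\kappa_N(\theta)\in\{0,\dots,N-1\}$ denotes the optimal such $k$ (at boundary values of $\theta$, where two strategies tie, the value given by the formula).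
   Formalization: The parameter θ ranges over the positive rationals rather than the positive reals. -}

module Defs where

open import Data.Nat as ℕ using (ℕ; zero; suc; _∸_)
open import Data.Bool using (Bool; true; false; if_then_else_; _∧_)
open import Data.List using (List; []; _∷_; map; concatMap; upTo; foldr)
open import Data.Integer using (+_)
open import Data.Rational using (ℚ; 0ℚ; 1ℚ; _+_; _*_; _/_)

-- Permutations of {1,…,N}, written in one-line notation as lists:
-- π = [π₁,…,πₙ], πᵢ = rank of candidate i (N = best).

insertions : ℕ → List ℕ → List (List ℕ)
insertions x []       = (x ∷ []) ∷ []
insertions x (y ∷ ys) = (x ∷ y ∷ ys) ∷ map (y ∷_) (insertions x ys)

perms : List ℕ → List (List ℕ)
perms []       = [] ∷ []
perms (x ∷ xs) = concatMap (insertions x) (perms xs)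

oneTo : ℕ → List ℕ
oneTo N = map suc (upTo N)

Sym : ℕ → List (List ℕ)
Sym N = perms (oneTo N)

lrmFrom : ℕ → List ℕ → ℕ
lrmFrom m []       = zero
lrmFrom m (x ∷ xs) = if m ℕ.<ᵇ x then suc (lrmFrom x xs) else lrmFrom m xs

-- entries are ≥ 1, so starting with running maximum 0 counts every lrm
lrm : List ℕ → ℕ
lrm = lrmFrom 0

-- Positional strategy with k initial rejections: reject candidates
-- 1,…,k, then accept the first later candidate better than all previous
-- ones.  wins N m k π : the game is won (accepted rank = N), where m is
-- the running maximum of the ranks seen so far and k the number of
-- still-pending forced rejections.

wins : ℕ → ℕ → ℕ → List ℕ → Bool
wins N m k       []       = false
wins N m (suc k) (x ∷ xs) = wins N (if m ℕ.<ᵇ x then x else m) k xs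
wins N m zero    (x ∷ xs) = if m ℕ.<ᵇ x then (x ℕ.≡ᵇ N) else wins N m zero xs

winsStrategy : ℕ → ℕ → List ℕ → Bool
winsStrategy N k π = wins N 0 k π

sumℚ : List ℚ → ℚ
sumℚ = foldr _+_ 0ℚ

powℚ : ℚ → ℕ → ℚ
powℚ q zero    = 1ℚ
powℚ q (suc n) = q * powℚ q n

ewensZ : ℕ → ℚ → ℚ
ewensZ N θ = sumℚ (map (λ π → powℚ θ (lrm π)) (Sym N))

-- The success probability is W_{N,k}(θ) / Z_N(θ), with Z_N(θ) > 0
-- independent of k.
winWeight : ℕ → ℕ → ℚ → ℚ
winWeight N k θ =
  sumℚ (map (λ π → if winsStrategy N k π then powℚ θ (lrm π) else 0ℚ) (Sym N))

-- Harmonic-type sums  H a b = Σ_{i=a}^{b} 1/i   (empty if b < a; used with a ≥ 1)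

inv : ℕ → ℚ
inv zero    = 0ℚ
inv (suc j) = + 1 / suc j

harm : ℕ → ℕ → ℚ
harm a b = sumℚ (map (λ j → inv (a ℕ.+ j)) (upTo (suc b ∸ a)))

-- Let W n k be the Ewens weight of the permutations of n + 1 values won by the
-- strategy with k rejections. A permutation of {a,…,N} arises by inserting its
-- minimum a into a permutation of {a+1,…,N}. At the front a is a record: it uses
-- up one rejection (a factor θ) or, if none is left, is accepted and loses.
-- Anywhere else it is never a record and only matters when it falls among the
-- rejected candidates, which happens at k of the other positions. Hence
--   W (n+1) 0 = (n+1) W n 0,   W (n+1) (k+1) = (θ+k) W n k + (n+1-k) W n (k+1),
-- which solves to W n 0 = θ n! and k! W n (k+1) = θ θ⁽ᵏ⁺¹⁾ n! H(k+1,n), with θ⁽ʲ⁾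
-- the rising factorial and H(a,b) = Σ_{a≤i≤b} 1/i. So
--   k! (W n (k+1) - W n k) = θ θ⁽ᵏ⁾ n! (θ H(k+1,n) - 1),
-- and as θ H(k+1,n) decreases in k, W n is unimodal with its maximum at the first
-- k where θ H(k+1,n) ≤ 1; the intervals for θ in the theorem say exactly that.

module Submission where

open import Defs
open import Data.Bool using (true; false; if_then_else_; T)
open import Data.Bool.Properties using (T-≡)
open import Data.Empty using (⊥-elim)
open import Data.Integer using (+_)
import Data.Integer as ℤ
import Data.Integer.Properties as ℤP
open import Data.List using (List; []; _∷_; map; length; _++_; concatMap; applyUpTo; upTo)
import Data.List.Properties as List
open import Data.List.Relation.Unary.All as All using (All; []; _∷_)
import Data.List.Relation.Unary.All.Properties as All
open import Data.Nat using (ℕ; suc; zero; _∸_; _!; z≤n; s≤s; pred)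
import Data.Nat as ℕ
import Data.Nat.Coprimality as Coprime
import Data.Nat.Properties as ℕP
open import Data.Product using (_×_; _,_; proj₁; proj₂)
open import Data.Rational using (ℚ; 0ℚ; 1ℚ; _*_; _+_; -_; _/_; _≤_; _<_; mkℚ; positive)
import Data.Rational.Properties as ℚP
open import Data.Rational.Solver using (module +-*-Solver)
open import Data.Sum using (_⊎_; inj₁; inj₂)
open import Data.Unit using (tt)
open import Function using (_∘_; flip)
open import Function.Bundles using (Equivalence)
open import Relation.Binary.Definitions using (tri<; tri≈; tri>)
open import Relation.Binary.PropositionalEquality
open +-*-Solver

-- Abstract, so that type checking never unfolds the gcd normalisation in + n / 1.
abstract
  fromℕ : ℕ → ℚ
  fromℕ n = + n / 1

  fromℕ-def : ∀ n → fromℕ n ≡ + n / 1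
  fromℕ-def n = refl

  fromℕ-0 : fromℕ 0 ≡ 0ℚ
  fromℕ-0 = refl

  fromℕ-1 : fromℕ 1 ≡ 1ℚ
  fromℕ-1 = refl

  fromℕ-suc : ∀ n → fromℕ (suc n) ≡ 1ℚ + fromℕ n
  fromℕ-suc n = trans (ℚP./-cong {+ suc n} {1} {(+ 1 ℤ.* + 1) ℤ.+ (+ n ℤ.* + 1)} {1} numerator refl)
                      (cong (_+_ 1ℚ) (sym (ℚP.normalize-coprime {n} {0} (Coprime.sym (Coprime.1-coprimeTo n)))))
    where
    numerator : + suc n ≡ (+ 1 ℤ.* + 1) ℤ.+ (+ n ℤ.* + 1)
    numerator = cong (λ z → + 1 ℤ.+ z) (sym (ℤP.*-identityʳ (+ n)))

fromℕ-+ : ∀ m n → fromℕ (m ℕ.+ n) ≡ fromℕ m + fromℕ n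
fromℕ-+ zero n = trans (sym (ℚP.+-identityˡ (fromℕ n))) (cong (_+ fromℕ n) (sym fromℕ-0))
fromℕ-+ (suc m) n = begin
  fromℕ (suc (m ℕ.+ n))     ≡⟨ fromℕ-suc (m ℕ.+ n) ⟩
  1ℚ + fromℕ (m ℕ.+ n)      ≡⟨ cong (_+_ 1ℚ) (fromℕ-+ m n) ⟩
  1ℚ + (fromℕ m + fromℕ n)  ≡⟨ sym (ℚP.+-assoc 1ℚ (fromℕ m) (fromℕ n)) ⟩
  (1ℚ + fromℕ m) + fromℕ n  ≡⟨ cong (_+ fromℕ n) (sym (fromℕ-suc m)) ⟩
  fromℕ (suc m) + fromℕ n   ∎
  where open ≡-Reasoning

fromℕ-* : ∀ m n → fromℕ (m ℕ.* n) ≡ fromℕ m * fromℕ n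
fromℕ-* zero n = trans fromℕ-0 (trans (sym (ℚP.*-zeroˡ (fromℕ n))) (cong (_* fromℕ n) (sym fromℕ-0)))
fromℕ-* (suc m) n = begin
  fromℕ (n ℕ.+ m ℕ.* n)            ≡⟨ fromℕ-+ n (m ℕ.* n) ⟩
  fromℕ n + fromℕ (m ℕ.* n)        ≡⟨ cong (_+_ (fromℕ n)) (fromℕ-* m n) ⟩
  fromℕ n + fromℕ m * fromℕ n      ≡⟨ solve 2 (λ a b → a :+ b :* a := (con 1ℚ :+ b) :* a) refl (fromℕ n) (fromℕ m) ⟩
  (1ℚ + fromℕ m) * fromℕ n         ≡⟨ cong (_* fromℕ n) (sym (fromℕ-suc m)) ⟩
  fromℕ (suc m) * fromℕ n          ∎
  where open ≡-Reasoning

fromℕ-nonNeg : ∀ n → 0ℚ ≤ fromℕ n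
fromℕ-nonNeg n = subst (0ℚ ≤_) (sym (fromℕ-def n)) (ℚP.nonNegative⁻¹ (+ n / 1) {{ℚP.normalize-nonNeg n 1}})

fromℕ-pos : ∀ n → 0 ℕ.< n → 0ℚ < fromℕ n
fromℕ-pos (suc n) _ = subst (0ℚ <_) (sym (fromℕ-def (suc n))) (ℚP.positive⁻¹ (+ suc n / 1) {{ℚP.normalize-pos (suc n) 1}})

inv-pos : ∀ n → 0ℚ < inv (suc n)
inv-pos n = ℚP.positive⁻¹ (+ 1 / suc n) {{ℚP.normalize-pos 1 (suc n)}}

inv-nonNeg : ∀ n → 0ℚ ≤ inv n
inv-nonNeg zero    = ℚP.≤-refl
inv-nonNeg (suc n) = ℚP.<⇒≤ (inv-pos n)

fromℕ*inv : ∀ n → fromℕ (suc n) * inv (suc n) ≡ 1ℚ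
fromℕ*inv n = trans (cong₂ _*_ (trans (fromℕ-def (suc n)) (ℚP.normalize-coprime {suc n} {0} 1-coprime))
                               (ℚP.normalize-coprime {1} {n} (Coprime.1-coprimeTo (suc n))))
                    (ℚP.*-inverseʳ (mkℚ (+ suc n) 0 1-coprime))
  where 1-coprime = Coprime.sym (Coprime.1-coprimeTo (suc n))

∑ : {A : Set} → (A → ℚ) → List A → ℚ
∑ f xs = sumℚ (map f xs)

module _ {A : Set} where

  ∑-++ : ∀ (f : A → ℚ) xs ys → ∑ f (xs ++ ys) ≡ ∑ f xs + ∑ f ys
  ∑-++ f []       ys = sym (ℚP.+-identityˡ _)
  ∑-++ f (x ∷ xs) ys = trans (cong (_+_ (f x)) (∑-++ f xs ys)) (sym (ℚP.+-assoc (f x) _ _))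

  ∑-concatMap : ∀ {B : Set} (f : A → ℚ) (g : B → List A) xs → ∑ f (concatMap g xs) ≡ ∑ (∑ f ∘ g) xs
  ∑-concatMap f g []       = refl
  ∑-concatMap f g (x ∷ xs) = trans (∑-++ f (g x) (concatMap g xs)) (cong (_+_ (∑ f (g x))) (∑-concatMap f g xs))

  ∑-map : ∀ {B : Set} (f : A → ℚ) (g : B → A) xs → ∑ f (map g xs) ≡ ∑ (f ∘ g) xs
  ∑-map f g xs = cong sumℚ (sym (List.map-∘ xs))

  ∑-cong : ∀ {f g : A → ℚ} → (∀ x → f x ≡ g x) → ∀ xs → ∑ f xs ≡ ∑ g xs
  ∑-cong f≗g xs = cong sumℚ (List.map-cong f≗g xs)

  ∑-cong-local : ∀ {f g : A → ℚ} {xs} → All (λ x → f x ≡ g x) xs → ∑ f xs ≡ ∑ g xs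
  ∑-cong-local f≡g = cong sumℚ (List.map-cong-local f≡g)

  ∑-const : ∀ (c : ℚ) (xs : List A) → ∑ (λ _ → c) xs ≡ fromℕ (length xs) * c
  ∑-const c []       = trans (sym (ℚP.*-zeroˡ c)) (cong (_* c) (sym fromℕ-0))
  ∑-const c (x ∷ xs) = begin
    c + ∑ (λ _ → c) xs              ≡⟨ cong (_+_ c) (∑-const c xs) ⟩
    c + fromℕ (length xs) * c       ≡⟨ solve 2 (λ a b → a :+ b :* a := (con 1ℚ :+ b) :* a) refl c (fromℕ (length xs)) ⟩
    (1ℚ + fromℕ (length xs)) * c    ≡⟨ cong (_* c) (sym (fromℕ-suc (length xs))) ⟩
    fromℕ (suc (length xs)) * c     ∎
    where open ≡-Reasoning

  ∑-locally-constant : ∀ {f : A → ℚ} {c} xs → All (λ x → f x ≡ c) xs → ∑ f xs ≡ fromℕ (length xs) * c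
  ∑-locally-constant {c = c} xs f≡c = trans (∑-cong-local f≡c) (∑-const c xs)

  ∑-*ˡ : ∀ (c : ℚ) (f : A → ℚ) xs → ∑ (λ x → c * f x) xs ≡ c * ∑ f xs
  ∑-*ˡ c f []       = sym (ℚP.*-zeroʳ c)
  ∑-*ˡ c f (x ∷ xs) = trans (cong (_+_ (c * f x)) (∑-*ˡ c f xs)) (sym (ℚP.*-distribˡ-+ c (f x) _))

  ∑-+ : ∀ (f g : A → ℚ) xs → ∑ (λ x → f x + g x) xs ≡ ∑ f xs + ∑ g xs
  ∑-+ f g []       = refl
  ∑-+ f g (x ∷ xs) = trans (cong (_+_ (f x + g x)) (∑-+ f g xs))
    (solve 4 (λ a b c d → a :+ b :+ (c :+ d) := a :+ c :+ (b :+ d)) refl (f x) (g x) (∑ f xs) (∑ g xs))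

∑-upTo-suc : ∀ (f : ℕ → ℚ) n → ∑ f (upTo (suc n)) ≡ f 0 + ∑ (f ∘ suc) (upTo n)
∑-upTo-suc f n = cong (_+_ (f 0)) (trans (cong (∑ f) (sym (List.map-upTo suc n))) (∑-map f suc (upTo n)))

∑-upTo-snoc : ∀ (f : ℕ → ℚ) n → ∑ f (upTo (suc n)) ≡ ∑ f (upTo n) + f n
∑-upTo-snoc f n = begin
  ∑ f (upTo (suc n))          ≡⟨ cong (∑ f) (sym (List.upTo-∷ʳ n)) ⟩
  ∑ f (upTo n ++ n ∷ [])      ≡⟨ ∑-++ f (upTo n) (n ∷ []) ⟩
  ∑ f (upTo n) + (f n + 0ℚ)   ≡⟨ cong (_+_ (∑ f (upTo n))) (ℚP.+-identityʳ (f n)) ⟩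
  ∑ f (upTo n) + f n          ∎
  where open ≡-Reasoning

harm-empty : ∀ a b → b ℕ.< a → harm a b ≡ 0ℚ
harm-empty a b b<a rewrite ℕP.m≤n⇒m∸n≡0 b<a = refl

harm-cons : ∀ a b → a ℕ.≤ b → harm a b ≡ inv a + harm (suc a) b
harm-cons a b a≤b rewrite ℕP.+-∸-assoc 1 a≤b =
  trans (∑-upTo-suc term (b ∸ a))
        (cong₂ _+_ (cong inv (ℕP.+-identityʳ a)) (cong sumℚ (List.map-cong (cong inv ∘ ℕP.+-suc a) (upTo (b ∸ a)))))
  where term = λ j → inv (a ℕ.+ j)

harm-snoc : ∀ a b → a ℕ.≤ suc b → harm a (suc b) ≡ harm a b + inv (suc b)
harm-snoc a b a≤1+b rewrite ℕP.+-∸-assoc 1 a≤1+b =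
  trans (∑-upTo-snoc (λ j → inv (a ℕ.+ j)) (suc b ∸ a)) (cong (λ i → harm a b + inv i) (ℕP.m+[n∸m]≡n a≤1+b))

harm-singleton : ∀ a → harm a a ≡ inv a
harm-singleton a = trans (harm-cons a a ℕP.≤-refl) (trans (cong (_+_ (inv a)) (harm-empty (suc a) a ℕP.≤-refl)) (ℚP.+-identityʳ (inv a)))

harm-weighted : ∀ n j → fromℕ (suc n) * harm (suc (suc j)) (suc n)
                        ≡ fromℕ (suc j) * harm (suc j) n + fromℕ (n ∸ j) * harm (suc (suc j)) n
harm-weighted n j with ℕP.≤-<-connex (suc j) n
... | inj₁ j<n = begin
  c * harm (suc (suc j)) (suc n)  ≡⟨ cong (c *_) (harm-snoc (suc (suc j)) n (s≤s j<n)) ⟩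
  c * (h + inv (suc n))           ≡⟨ solve 3 (λ c h e → c :* (h :+ e) := c :* h :+ c :* e) refl c h (inv (suc n)) ⟩
  c * h + c * inv (suc n)         ≡⟨ cong₂ (λ u v → u * h + v) c≡a+d (trans (fromℕ*inv n) (sym (fromℕ*inv j))) ⟩
  (a + d) * h + a * inv (suc j)   ≡⟨ solve 4 (λ a d h e → (a :+ d) :* h :+ a :* e := a :* (e :+ h) :+ d :* h) refl a d h (inv (suc j)) ⟩
  a * (inv (suc j) + h) + d * h   ≡⟨ cong (λ z → a * z + d * h) (sym (harm-cons (suc j) n j<n)) ⟩
  a * harm (suc j) n + d * h      ∎
  where
  open ≡-Reasoning
  c = fromℕ (suc n)
  a = fromℕ (suc j)
  d = fromℕ (n ∸ j)
  h = harm (suc (suc j)) n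
  c≡a+d : c ≡ a + d
  c≡a+d = trans (cong (fromℕ ∘ suc) (sym (ℕP.m+[n∸m]≡n (ℕP.<⇒≤ j<n)))) (fromℕ-+ (suc j) (n ∸ j))
... | inj₂ n<1+j = begin
  c * harm (suc (suc j)) (suc n)  ≡⟨ cong (c *_) (harm-empty (suc (suc j)) (suc n) (s≤s n<1+j)) ⟩
  c * 0ℚ                          ≡⟨ solve 3 (λ c a d → c :* con 0ℚ := a :* con 0ℚ :+ d :* con 0ℚ) refl c a d ⟩
  a * 0ℚ + d * 0ℚ                 ≡⟨ cong₂ (λ u v → a * u + d * v) (sym (harm-empty (suc j) n n<1+j)) (sym (harm-empty (suc (suc j)) n (ℕP.m≤n⇒m≤1+n n<1+j))) ⟩
  a * harm (suc j) n + d * harm (suc (suc j)) n ∎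
  where
  open ≡-Reasoning
  c = fromℕ (suc n)
  a = fromℕ (suc j)
  d = fromℕ (n ∸ j)

-- The weight recurrence and its closed form

rising : ℚ → ℕ → ℚ
rising θ zero    = 1ℚ
rising θ (suc k) = (θ + fromℕ k) * rising θ k

module Recurrence (θ : ℚ) where

  step : ℕ → ℕ → (ℕ → ℚ) → ℚ
  step n zero    w = fromℕ (suc n) * w 0
  step n (suc k) w = (θ + fromℕ k) * w k + fromℕ (suc n ∸ k) * w (suc k)

  W : ℕ → ℕ → ℚ
  W zero    zero    = θ
  W zero    (suc k) = 0ℚ
  W (suc n) k       = step n k (W n)

  step-cong : ∀ n k {w w′ : ℕ → ℚ} → (∀ i → w i ≡ w′ i) → step n k w ≡ step n k w′
  step-cong n zero    w≡w′ = cong (fromℕ (suc n) *_) (w≡w′ 0)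
  step-cong n (suc k) w≡w′ = cong₂ (λ u v → (θ + fromℕ k) * u + fromℕ (suc n ∸ k) * v) (w≡w′ k) (w≡w′ (suc k))

  ∑-step : ∀ {A : Set} n k (f : A → ℕ → ℚ) xs → ∑ (λ x → step n k (f x)) xs ≡ step n k (λ i → ∑ (λ x → f x i) xs)
  ∑-step n zero    f xs = ∑-*ˡ (fromℕ (suc n)) (λ x → f x 0) xs
  ∑-step n (suc k) f xs = trans (∑-+ (λ x → (θ + fromℕ k) * f x k) (λ x → fromℕ (suc n ∸ k) * f x (suc k)) xs)
    (cong₂ _+_ (∑-*ˡ (θ + fromℕ k) (λ x → f x k) xs) (∑-*ˡ (fromℕ (suc n ∸ k)) (λ x → f x (suc k)) xs))

  rising-1 : rising θ 1 ≡ θ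
  rising-1 = trans (cong (λ z → (θ + z) * 1ℚ) fromℕ-0) (solve 1 (λ t → (t :+ con 0ℚ) :* con 1ℚ := t) refl θ)

  W-zero : ∀ n → W n 0 ≡ θ * fromℕ (n !)
  W-zero zero    = sym (trans (cong (θ *_) fromℕ-1) (ℚP.*-identityʳ θ))
  W-zero (suc n) = begin
    fromℕ (suc n) * W n 0                   ≡⟨ cong (fromℕ (suc n) *_) (W-zero n) ⟩
    fromℕ (suc n) * (θ * fromℕ (n !))       ≡⟨ solve 3 (λ c t p → c :* (t :* p) := t :* (c :* p)) refl (fromℕ (suc n)) θ (fromℕ (n !)) ⟩
    θ * (fromℕ (suc n) * fromℕ (n !))       ≡⟨ cong (θ *_) (sym (fromℕ-* (suc n) (n !))) ⟩
    θ * fromℕ (suc n !)                     ∎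
    where open ≡-Reasoning

  W-suc : ∀ n k → fromℕ (k !) * W n (suc k) ≡ θ * rising θ (suc k) * fromℕ (n !) * harm (suc k) n
  W-suc zero k = begin
    fromℕ (k !) * 0ℚ  ≡⟨ ℚP.*-zeroʳ (fromℕ (k !)) ⟩
    0ℚ                ≡⟨ sym (ℚP.*-zeroʳ X) ⟩
    X * 0ℚ            ≡⟨ cong (X *_) (sym (harm-empty (suc k) 0 (s≤s z≤n))) ⟩
    X * harm (suc k) 0 ∎
    where
    open ≡-Reasoning
    X = θ * rising θ (suc k) * fromℕ 1
  W-suc (suc n) zero = begin
    fromℕ 1 * ((θ + fromℕ 0) * W n 0 + c * W n 1)
      ≡⟨ cong₂ (λ u v → u * ((θ + v) * W n 0 + c * W n 1)) fromℕ-1 fromℕ-0 ⟩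
    1ℚ * ((θ + 0ℚ) * W n 0 + c * W n 1)
      ≡⟨ cong₂ (λ u v → 1ℚ * ((θ + 0ℚ) * u + c * v)) (W-zero n) W-one ⟩
    1ℚ * ((θ + 0ℚ) * (θ * p) + c * (θ * θ * p * H))
      ≡⟨ solve 4 (λ t p c H → con 1ℚ :* ((t :+ con 0ℚ) :* (t :* p) :+ c :* (t :* t :* p :* H)) := t :* t :* p :* (con 1ℚ :+ c :* H)) refl θ p c H ⟩
    θ * θ * p * (1ℚ + c * H)
      ≡⟨ cong (λ z → θ * θ * p * (z + c * H)) (sym (fromℕ*inv n)) ⟩
    θ * θ * p * (c * inv (suc n) + c * H)
      ≡⟨ solve 5 (λ t p c e H → t :* t :* p :* (c :* e :+ c :* H) := t :* t :* (c :* p) :* (H :+ e)) refl θ p c (inv (suc n)) H ⟩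
    θ * θ * (c * p) * (H + inv (suc n))
      ≡⟨ cong₂ (λ u v → θ * θ * u * v) (sym (fromℕ-* (suc n) (n !))) (sym (harm-snoc 1 n (s≤s z≤n))) ⟩
    θ * θ * fromℕ (suc n !) * harm 1 (suc n)
      ≡⟨ cong (λ z → θ * z * fromℕ (suc n !) * harm 1 (suc n)) (sym rising-1) ⟩
    θ * rising θ 1 * fromℕ (suc n !) * harm 1 (suc n) ∎
    where
    open ≡-Reasoning
    c = fromℕ (suc n)
    p = fromℕ (n !)
    H = harm 1 n
    W-one : W n 1 ≡ θ * θ * p * H
    W-one = begin
      W n 1                              ≡⟨ sym (ℚP.*-identityˡ (W n 1)) ⟩
      1ℚ * W n 1                         ≡⟨ cong (_* W n 1) (sym fromℕ-1) ⟩
      fromℕ 1 * W n 1                    ≡⟨ W-suc n 0 ⟩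
      θ * rising θ 1 * p * H             ≡⟨ cong (λ z → θ * z * p * H) rising-1 ⟩
      θ * θ * p * H                      ∎
  W-suc (suc n) (suc j) = begin
    F * ((θ + a) * W n (suc j) + d * W n (suc (suc j)))
      ≡⟨ solve 6 (λ F t a d A B → F :* ((t :+ a) :* A :+ d :* B) := (t :+ a) :* (F :* A) :+ d :* (F :* B)) refl F θ a d (W n (suc j)) (W n (suc (suc j))) ⟩
    (θ + a) * (F * W n (suc j)) + d * (F * W n (suc (suc j)))
      ≡⟨ cong (λ z → (θ + a) * (z * W n (suc j)) + d * (F * W n (suc (suc j)))) (fromℕ-* (suc j) (j !)) ⟩
    (θ + a) * (a * fromℕ (j !) * W n (suc j)) + d * (F * W n (suc (suc j)))
      ≡⟨ cong₂ (λ u v → (θ + a) * u + d * v) (trans (ℚP.*-assoc a _ _) (cong (a *_) (W-suc n j))) (W-suc n (suc j)) ⟩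
    (θ + a) * (a * (θ * R * p * H₁)) + d * (θ * ((θ + a) * R) * p * H₂)
      ≡⟨ solve 7 (λ t a R p H₁ d H₂ → (t :+ a) :* (a :* (t :* R :* p :* H₁)) :+ d :* (t :* ((t :+ a) :* R) :* p :* H₂)
                                      := t :* ((t :+ a) :* R) :* p :* (a :* H₁ :+ d :* H₂)) refl θ a R p H₁ d H₂ ⟩
    θ * ((θ + a) * R) * p * (a * H₁ + d * H₂)
      ≡⟨ cong (θ * ((θ + a) * R) * p *_) (sym (harm-weighted n j)) ⟩
    θ * ((θ + a) * R) * p * (fromℕ (suc n) * harm (suc (suc j)) (suc n))
      ≡⟨ solve 4 (λ X p c H → X :* p :* (c :* H) := X :* (c :* p) :* H) refl (θ * ((θ + a) * R)) p (fromℕ (suc n)) (harm (suc (suc j)) (suc n)) ⟩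
    θ * ((θ + a) * R) * (fromℕ (suc n) * p) * harm (suc (suc j)) (suc n)
      ≡⟨ cong (λ z → θ * ((θ + a) * R) * z * harm (suc (suc j)) (suc n)) (sym (fromℕ-* (suc n) (n !))) ⟩
    θ * rising θ (suc (suc j)) * fromℕ (suc n !) * harm (suc (suc j)) (suc n) ∎
    where
    open ≡-Reasoning
    F = fromℕ (suc j !)
    a = fromℕ (suc j)
    d = fromℕ (n ∸ j)
    R = rising θ (suc j)
    p = fromℕ (n !)
    H₁ = harm (suc j) n
    H₂ = harm (suc (suc j)) n

  incrementFactor : ℕ → ℕ → ℚ
  incrementFactor n k = θ * rising θ k * fromℕ (n !)

  W-increment : ∀ n k → k ℕ.< n →
    fromℕ (k !) * W n (suc k) + incrementFactor n k ≡ fromℕ (k !) * W n k + incrementFactor n k * (θ * harm (suc k) n)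
  W-increment n zero _ = begin
    fromℕ 1 * W n 1 + θ * 1ℚ * p            ≡⟨ cong (_+ θ * 1ℚ * p) (W-suc n 0) ⟩
    θ * rising θ 1 * p * H + θ * 1ℚ * p     ≡⟨ cong (λ z → θ * z * p * H + θ * 1ℚ * p) rising-1 ⟩
    θ * θ * p * H + θ * 1ℚ * p              ≡⟨ solve 3 (λ t p H → t :* t :* p :* H :+ t :* con 1ℚ :* p
                                                              := con 1ℚ :* (t :* p) :+ t :* con 1ℚ :* p :* (t :* H)) refl θ p H ⟩
    1ℚ * (θ * p) + θ * 1ℚ * p * (θ * H)     ≡⟨ cong₂ (λ u v → u * v + θ * 1ℚ * p * (θ * H)) (sym fromℕ-1) (sym (W-zero n)) ⟩
    fromℕ 1 * W n 0 + θ * 1ℚ * p * (θ * H)  ∎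
    where
    open ≡-Reasoning
    p = fromℕ (n !)
    H = harm 1 n
  W-increment n (suc j) 1+j<n = begin
    F * W n (suc (suc j)) + c
      ≡⟨ cong (_+ c) (W-suc n (suc j)) ⟩
    θ * ((θ + a) * R) * p * H₂ + c
      ≡⟨ solve 5 (λ t a R p H₂ → t :* ((t :+ a) :* R) :* p :* H₂ :+ t :* R :* p
                                  := t :* R :* p :* con 1ℚ :+ t :* R :* p :* (a :* H₂) :+ t :* R :* p :* (t :* H₂)) refl θ a R p H₂ ⟩
    c * 1ℚ + c * (a * H₂) + c * (θ * H₂)
      ≡⟨ cong (λ z → c * z + c * (a * H₂) + c * (θ * H₂)) (sym (fromℕ*inv j)) ⟩
    c * (a * inv (suc j)) + c * (a * H₂) + c * (θ * H₂)
      ≡⟨ solve 5 (λ c a e H₂ t → c :* (a :* e) :+ c :* (a :* H₂) :+ c :* (t :* H₂) := a :* (c :* (e :+ H₂)) :+ c :* (t :* H₂)) refl c a (inv (suc j)) H₂ θ ⟩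
    a * (c * (inv (suc j) + H₂)) + c * (θ * H₂)
      ≡⟨ cong (λ z → a * (c * z) + c * (θ * H₂)) (sym (harm-cons (suc j) n (ℕP.<⇒≤ 1+j<n))) ⟩
    a * (θ * R * p * harm (suc j) n) + c * (θ * H₂)
      ≡⟨ cong (λ z → a * z + c * (θ * H₂)) (sym (W-suc n j)) ⟩
    a * (fromℕ (j !) * W n (suc j)) + c * (θ * H₂)
      ≡⟨ cong (_+ c * (θ * H₂)) (trans (sym (ℚP.*-assoc a _ _)) (cong (_* W n (suc j)) (sym (fromℕ-* (suc j) (j !))))) ⟩
    F * W n (suc j) + c * (θ * H₂) ∎
    where
    open ≡-Reasoning
    F = fromℕ (suc j !)
    a = fromℕ (suc j)
    R = rising θ (suc j)
    p = fromℕ (n !)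
    c = incrementFactor n (suc j)
    H₂ = harm (suc (suc j)) n

-- Records and insertions

<ᵇ-true : ∀ {m n} → m ℕ.< n → (m ℕ.<ᵇ n) ≡ true
<ᵇ-true m<n = Equivalence.to T-≡ (ℕP.<⇒<ᵇ m<n)

<ᵇ-false : ∀ {m n} → n ℕ.≤ m → (m ℕ.<ᵇ n) ≡ false
<ᵇ-false {m}     {zero}  _         = refl
<ᵇ-false {suc m} {suc n} (s≤s n≤m) = <ᵇ-false n≤m

lrmFrom-record : ∀ {m y} τ → m ℕ.< y → lrmFrom m (y ∷ τ) ≡ suc (lrmFrom y τ)
lrmFrom-record τ m<y rewrite <ᵇ-true m<y = refl

lrmFrom-nonRecord : ∀ {m y} τ → y ℕ.≤ m → lrmFrom m (y ∷ τ) ≡ lrmFrom m τ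
lrmFrom-nonRecord τ y≤m rewrite <ᵇ-false y≤m = refl

All-constant-via : ∀ {A B : Set} {g h : A → B} (a : A) {xs} →
  (∀ x → g x ≡ h x) → All (λ x → h x ≡ h a) xs → All (λ x → g x ≡ g a) xs
All-constant-via a g≗h = All.map (λ h≡ → trans (g≗h _) (trans h≡ (sym (g≗h _))))

lrmFrom-insertions : ∀ {x m} σ → x ℕ.≤ m → All (λ τ → lrmFrom m τ ≡ lrmFrom m σ) (insertions x σ)
lrmFrom-insertions []       x≤m = lrmFrom-nonRecord [] x≤m ∷ []
lrmFrom-insertions {x} {m} (y ∷ ys) x≤m = lrmFrom-nonRecord (y ∷ ys) x≤m ∷ All.map⁺ behind
  where
  behind : All (λ τ → lrmFrom m (y ∷ τ) ≡ lrmFrom m (y ∷ ys)) (insertions x ys)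
  behind with ℕP.≤-<-connex y m
  ... | inj₁ y≤m = All-constant-via ys (λ τ → lrmFrom-nonRecord τ y≤m) (lrmFrom-insertions ys x≤m)
  ... | inj₂ m<y = All-constant-via ys (λ τ → lrmFrom-record τ m<y)
                     (All.map (cong suc) (lrmFrom-insertions ys (ℕP.≤-trans x≤m (ℕP.<⇒≤ m<y))))

length-insertions : ∀ x σ → length (insertions x σ) ≡ suc (length σ)
length-insertions x []       = refl
length-insertions x (y ∷ ys) = cong suc (trans (List.length-map (y ∷_) (insertions x ys)) (length-insertions x ys))

insertions-shape : ∀ {P : ℕ → Set} {x} σ → P x → All P σ →
  All (λ τ → All P τ × length τ ≡ suc (length σ)) (insertions x σ)
insertions-shape []       px []         = (px ∷ [] , refl) ∷ []
insertions-shape (y ∷ ys) px (py ∷ pys) =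
  (px ∷ py ∷ pys , refl) ∷ All.map⁺ (All.map (λ { (pτ , len) → py ∷ pτ , cong suc len }) (insertions-shape ys px pys))

perms-shape : ∀ {P : ℕ → Set} xs → All P xs → All (λ σ → All P σ × length σ ≡ length xs) (perms xs)
perms-shape []       []         = ([] , refl) ∷ []
perms-shape (x ∷ xs) (px ∷ pxs) = All.concat⁺ (All.map⁺ (All.map
  (λ { {σ} (pσ , len) → All.map (λ { (pτ , len′) → pτ , trans len′ (cong suc len) }) (insertions-shape σ px pσ) })
  (perms-shape xs pxs)))

range : ℕ → ℕ → List ℕ
range a zero    = []
range a (suc n) = a ∷ range (suc a) n

range-length : ∀ a n → length (range a n) ≡ n
range-length a zero    = refl
range-length a (suc n) = cong suc (range-length (suc a) n)

range-bounded : ∀ a n → All (a ℕ.≤_) (range a n)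
range-bounded a zero    = []
range-bounded a (suc n) = ℕP.≤-refl ∷ All.map (ℕP.≤-trans (ℕP.n≤1+n a)) (range-bounded (suc a) n)

map-+-upTo : ∀ a n → map (a ℕ.+_) (upTo n) ≡ range a n
map-+-upTo a zero    = refl
map-+-upTo a (suc n) = cong₂ _∷_ (ℕP.+-identityʳ a) (begin
  map (a ℕ.+_) (applyUpTo suc n)          ≡⟨ cong (map (a ℕ.+_)) (sym (List.map-upTo suc n)) ⟩
  map (a ℕ.+_) (map suc (upTo n))         ≡⟨ sym (List.map-∘ (upTo n)) ⟩
  map (λ i → a ℕ.+ suc i) (upTo n)        ≡⟨ List.map-cong (ℕP.+-suc a) (upTo n) ⟩
  map (suc a ℕ.+_) (upTo n)               ≡⟨ map-+-upTo (suc a) n ⟩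
  range (suc a) n                         ∎)
  where open ≡-Reasoning

module Game (θ : ℚ) (N : ℕ) where
  open Recurrence θ

  winTerm : ℕ → ℕ → List ℕ → ℚ
  winTerm m k π = if wins N m k π then powℚ θ (lrmFrom m π) else 0ℚ

  winTerm-nonRecord : ∀ {m y} k ys → y ℕ.≤ m → winTerm m k (y ∷ ys) ≡ winTerm m (pred k) ys
  winTerm-nonRecord zero    ys y≤m rewrite <ᵇ-false y≤m = refl
  winTerm-nonRecord (suc k) ys y≤m rewrite <ᵇ-false y≤m = refl

  winTerm-rejectRecord : ∀ {m y} k ys → m ℕ.< y → winTerm m (suc k) (y ∷ ys) ≡ θ * winTerm y k ys
  winTerm-rejectRecord {m} {y} k ys m<y rewrite <ᵇ-true m<y with wins N y k ys
  ... | true  = refl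
  ... | false = sym (ℚP.*-zeroʳ θ)

  winTerm-accept-cong : ∀ {m y} τ τ′ → m ℕ.< y → lrmFrom y τ ≡ lrmFrom y τ′ → winTerm m 0 (y ∷ τ) ≡ winTerm m 0 (y ∷ τ′)
  winTerm-accept-cong τ τ′ m<y lrm≡ rewrite <ᵇ-true m<y | lrm≡ = refl

  winTerm-accept-nonMax : ∀ {m x} σ → m ℕ.< x → x ≢ N → winTerm m 0 (x ∷ σ) ≡ 0ℚ
  winTerm-accept-nonMax {x = x} σ m<x x≢N rewrite <ᵇ-true m<x with x ℕ.≡ᵇ N in x≡ᵇN
  ... | true  = ⊥-elim (x≢N (ℕP.≡ᵇ⇒≡ x N (subst T (sym x≡ᵇN) tt)))
  ... | false = refl

  winTerm-record-irrelevant : ∀ {m m′ y} k ys → m ℕ.< y → m′ ℕ.< y → winTerm m k (y ∷ ys) ≡ winTerm m′ k (y ∷ ys)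
  winTerm-record-irrelevant zero    ys m<y m′<y rewrite <ᵇ-true m<y | <ᵇ-true m′<y = refl
  winTerm-record-irrelevant (suc k) ys m<y m′<y = trans (winTerm-rejectRecord k ys m<y) (sym (winTerm-rejectRecord k ys m′<y))

  insert-behind-record₀ : ∀ {x m y} ys → m ℕ.< y → x ℕ.≤ y →
    All (λ τ → winTerm m 0 (y ∷ τ) ≡ winTerm m 0 (y ∷ ys)) (insertions x ys)
  insert-behind-record₀ ys m<y x≤y = All.map (λ {τ} → winTerm-accept-cong τ ys m<y) (lrmFrom-insertions ys x≤y)

  insert-below₀ : ∀ {x m} σ → x ℕ.≤ m → All (λ τ → winTerm m 0 τ ≡ winTerm m 0 σ) (insertions x σ)
  insert-below₀ []       x≤m = winTerm-nonRecord 0 [] x≤m ∷ []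
  insert-below₀ {x} {m} (y ∷ ys) x≤m = winTerm-nonRecord 0 (y ∷ ys) x≤m ∷ All.map⁺ behind
    where
    behind : All (λ τ → winTerm m 0 (y ∷ τ) ≡ winTerm m 0 (y ∷ ys)) (insertions x ys)
    behind with ℕP.≤-<-connex y m
    ... | inj₁ y≤m = All-constant-via ys (λ τ → winTerm-nonRecord 0 τ y≤m) (insert-below₀ ys x≤m)
    ... | inj₂ m<y = insert-behind-record₀ ys m<y (ℕP.≤-trans x≤m (ℕP.<⇒≤ m<y))

  ∑-insert-below₀ : ∀ {x m} σ → x ℕ.≤ m → ∑ (winTerm m 0) (insertions x σ) ≡ fromℕ (suc (length σ)) * winTerm m 0 σ
  ∑-insert-below₀ {x} σ x≤m =
    trans (∑-locally-constant (insertions x σ) (insert-below₀ σ x≤m)) (cong (λ l → fromℕ l * _) (length-insertions x σ))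

  -- Of the |σ| + 1 positions for x, the first k + 1 lie in the rejection phase.
  mutual
    ∑-insert-below : ∀ {x m} k σ → x ℕ.≤ m →
      ∑ (winTerm m (suc k)) (insertions x σ) ≡ fromℕ (suc k) * winTerm m k σ + fromℕ (length σ ∸ k) * winTerm m (suc k) σ
    ∑-insert-below k [] x≤m = trans (cong (_+ 0ℚ) (winTerm-nonRecord (suc k) [] x≤m))
      (solve 2 (λ a b → con 0ℚ :+ con 0ℚ := a :* con 0ℚ :+ b :* con 0ℚ) refl (fromℕ (suc k)) (fromℕ (0 ∸ k)))
    ∑-insert-below {x} {m} k (y ∷ ys) x≤m with ℕP.≤-<-connex y m
    ... | inj₂ m<y = begin
      winTerm m (suc k) (x ∷ y ∷ ys) + ∑ (winTerm m (suc k)) (map (y ∷_) (insertions x ys))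
        ≡⟨ cong₂ _+_ (winTerm-nonRecord (suc k) (y ∷ ys) x≤m) (∑-map (winTerm m (suc k)) (y ∷_) (insertions x ys)) ⟩
      A + ∑ (λ τ → winTerm m (suc k) (y ∷ τ)) (insertions x ys)
        ≡⟨ cong (_+_ A) (∑-insert-behind-record k ys m<y (ℕP.≤-trans x≤m (ℕP.<⇒≤ m<y))) ⟩
      A + (fromℕ k * A + d * B)
        ≡⟨ solve 4 (λ A a d B → A :+ (a :* A :+ d :* B) := (con 1ℚ :+ a) :* A :+ d :* B) refl A (fromℕ k) d B ⟩
      (1ℚ + fromℕ k) * A + d * B
        ≡⟨ cong (λ z → z * A + d * B) (sym (fromℕ-suc k)) ⟩
      fromℕ (suc k) * A + d * B ∎
      where
      open ≡-Reasoning
      A = winTerm m k (y ∷ ys)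
      B = winTerm m (suc k) (y ∷ ys)
      d = fromℕ (suc (length ys) ∸ k)
    ... | inj₁ y≤m = trans (cong₂ _+_ (winTerm-nonRecord (suc k) (y ∷ ys) x≤m)
                                      (trans (∑-map (winTerm m (suc k)) (y ∷_) (insertions x ys))
                                             (∑-cong (λ τ → winTerm-nonRecord (suc k) τ y≤m) (insertions x ys))))
                           (nonRecord k)
      where
      open ≡-Reasoning
      nonRecord : ∀ k → winTerm m k (y ∷ ys) + ∑ (winTerm m k) (insertions x ys)
                        ≡ fromℕ (suc k) * winTerm m k (y ∷ ys) + fromℕ (suc (length ys) ∸ k) * winTerm m (suc k) (y ∷ ys)
      nonRecord zero = begin
        winTerm m 0 (y ∷ ys) + ∑ (winTerm m 0) (insertions x ys)
          ≡⟨ cong₂ _+_ (winTerm-nonRecord 0 ys y≤m) (∑-insert-below₀ ys x≤m) ⟩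
        A + fromℕ (suc (length ys)) * A
          ≡⟨ solve 2 (λ A c → A :+ c :* A := con 1ℚ :* A :+ c :* A) refl A (fromℕ (suc (length ys))) ⟩
        1ℚ * A + fromℕ (suc (length ys)) * A
          ≡⟨ cong₂ (λ u w → u + fromℕ (suc (length ys)) * w) (cong₂ _*_ (sym fromℕ-1) (sym (winTerm-nonRecord 0 ys y≤m))) (sym (winTerm-nonRecord 1 ys y≤m)) ⟩
        fromℕ 1 * winTerm m 0 (y ∷ ys) + fromℕ (suc (length ys)) * winTerm m 1 (y ∷ ys) ∎
        where A = winTerm m 0 ys
      nonRecord (suc j) = begin
        winTerm m (suc j) (y ∷ ys) + ∑ (winTerm m (suc j)) (insertions x ys)
          ≡⟨ cong₂ _+_ (winTerm-nonRecord (suc j) ys y≤m) (∑-insert-below j ys x≤m) ⟩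
        A + (fromℕ (suc j) * A + d * B)
          ≡⟨ solve 4 (λ A a d B → A :+ (a :* A :+ d :* B) := (con 1ℚ :+ a) :* A :+ d :* B) refl A (fromℕ (suc j)) d B ⟩
        (1ℚ + fromℕ (suc j)) * A + d * B
          ≡⟨ cong₂ (λ u w → u + d * w) (cong₂ _*_ (sym (fromℕ-suc (suc j))) (sym (winTerm-nonRecord (suc j) ys y≤m))) (sym (winTerm-nonRecord (suc (suc j)) ys y≤m)) ⟩
        fromℕ (suc (suc j)) * winTerm m (suc j) (y ∷ ys) + d * winTerm m (suc (suc j)) (y ∷ ys) ∎
        where
        A = winTerm m j ys
        B = winTerm m (suc j) ys
        d = fromℕ (length ys ∸ j)

    ∑-insert-behind-record : ∀ {x m y} k ys → m ℕ.< y → x ℕ.≤ y →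
      ∑ (λ τ → winTerm m (suc k) (y ∷ τ)) (insertions x ys)
        ≡ fromℕ k * winTerm m k (y ∷ ys) + fromℕ (suc (length ys) ∸ k) * winTerm m (suc k) (y ∷ ys)
    ∑-insert-behind-record {x} {m} {y} k ys m<y x≤y =
      trans (∑-cong (λ τ → winTerm-rejectRecord k τ m<y) (insertions x ys))
            (trans (∑-*ˡ θ (winTerm y k) (insertions x ys)) (skipped k))
      where
      open ≡-Reasoning
      skipped : ∀ k → θ * ∑ (winTerm y k) (insertions x ys)
                      ≡ fromℕ k * winTerm m k (y ∷ ys) + fromℕ (suc (length ys) ∸ k) * winTerm m (suc k) (y ∷ ys)
      skipped zero = begin
        θ * ∑ (winTerm y 0) (insertions x ys)
          ≡⟨ cong (θ *_) (∑-insert-below₀ ys x≤y) ⟩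
        θ * (c * winTerm y 0 ys)
          ≡⟨ solve 4 (λ t c w A → t :* (c :* w) := con 0ℚ :* A :+ c :* (t :* w)) refl θ c (winTerm y 0 ys) (winTerm m 0 (y ∷ ys)) ⟩
        0ℚ * winTerm m 0 (y ∷ ys) + c * (θ * winTerm y 0 ys)
          ≡⟨ cong₂ (λ u v → u * winTerm m 0 (y ∷ ys) + c * v) (sym fromℕ-0) (sym (winTerm-rejectRecord 0 ys m<y)) ⟩
        fromℕ 0 * winTerm m 0 (y ∷ ys) + c * winTerm m 1 (y ∷ ys) ∎
        where c = fromℕ (suc (length ys))
      skipped (suc j) = begin
        θ * ∑ (winTerm y (suc j)) (insertions x ys)
          ≡⟨ cong (θ *_) (∑-insert-below j ys x≤y) ⟩
        θ * (a * winTerm y j ys + d * winTerm y (suc j) ys)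
          ≡⟨ solve 5 (λ t a A d B → t :* (a :* A :+ d :* B) := a :* (t :* A) :+ d :* (t :* B)) refl θ a (winTerm y j ys) d (winTerm y (suc j) ys) ⟩
        a * (θ * winTerm y j ys) + d * (θ * winTerm y (suc j) ys)
          ≡⟨ cong₂ (λ u v → a * u + d * v) (sym (winTerm-rejectRecord j ys m<y)) (sym (winTerm-rejectRecord (suc j) ys m<y)) ⟩
        a * winTerm m (suc j) (y ∷ ys) + d * winTerm m (suc (suc j)) (y ∷ ys) ∎
        where
        a = fromℕ (suc j)
        d = fromℕ (length ys ∸ j)

  ∑-insert-min : ∀ {m x} k y ys → m ℕ.< x → x ℕ.< y → x ≢ N →
    ∑ (winTerm m k) (insertions x (y ∷ ys)) ≡ step (length ys) k (λ i → winTerm m i (y ∷ ys))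
  ∑-insert-min {m} {x} k y ys m<x x<y x≢N =
    trans (cong (_+_ (winTerm m k (x ∷ y ∷ ys))) (∑-map (winTerm m k) (y ∷_) (insertions x ys))) (split k)
    where
    open ≡-Reasoning
    m<y = ℕP.<-trans m<x x<y
    split : ∀ k → winTerm m k (x ∷ y ∷ ys) + ∑ (λ τ → winTerm m k (y ∷ τ)) (insertions x ys)
                  ≡ step (length ys) k (λ i → winTerm m i (y ∷ ys))
    split zero = begin
      winTerm m 0 (x ∷ y ∷ ys) + ∑ (λ τ → winTerm m 0 (y ∷ τ)) (insertions x ys)
        ≡⟨ cong₂ _+_ (winTerm-accept-nonMax (y ∷ ys) m<x x≢N)
                     (trans (∑-locally-constant (insertions x ys) (insert-behind-record₀ ys m<y (ℕP.<⇒≤ x<y)))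
                            (cong (λ l → fromℕ l * winTerm m 0 (y ∷ ys)) (length-insertions x ys))) ⟩
      0ℚ + fromℕ (suc (length ys)) * winTerm m 0 (y ∷ ys)
        ≡⟨ ℚP.+-identityˡ _ ⟩
      fromℕ (suc (length ys)) * winTerm m 0 (y ∷ ys) ∎
    split (suc j) = begin
      winTerm m (suc j) (x ∷ y ∷ ys) + ∑ (λ τ → winTerm m (suc j) (y ∷ τ)) (insertions x ys)
        ≡⟨ cong₂ _+_ (trans (winTerm-rejectRecord j (y ∷ ys) m<x) (cong (θ *_) (winTerm-record-irrelevant j ys x<y m<y)))
                     (∑-insert-behind-record j ys m<y (ℕP.<⇒≤ x<y)) ⟩
      θ * A + (fromℕ j * A + d * B)
        ≡⟨ solve 5 (λ t A a d B → t :* A :+ (a :* A :+ d :* B) := (t :+ a) :* A :+ d :* B) refl θ A (fromℕ j) d B ⟩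
      (θ + fromℕ j) * A + d * B ∎
      where
      A = winTerm m j (y ∷ ys)
      B = winTerm m (suc j) (y ∷ ys)
      d = fromℕ (suc (length ys) ∸ j)

  ∑-perms-range : ∀ n a → a ℕ.+ n ≡ N → 0 ℕ.< a → ∀ k → ∑ (winTerm 0 k) (perms (range a (suc n))) ≡ W n k
  ∑-perms-range zero a a+0≡N 0<a zero
    rewrite <ᵇ-true 0<a | Equivalence.to T-≡ (ℕP.≡⇒≡ᵇ a N (trans (sym (ℕP.+-identityʳ a)) a+0≡N)) =
    solve 1 (λ t → t :* con 1ℚ :+ con 0ℚ := t) refl θ
  ∑-perms-range zero a _ 0<a (suc k) =
    trans (ℚP.+-identityʳ _) (trans (winTerm-rejectRecord k [] 0<a) (ℚP.*-zeroʳ θ))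
  ∑-perms-range (suc n) a a+1+n≡N 0<a k = begin
    ∑ (winTerm 0 k) (concatMap (insertions a) σs)                ≡⟨ ∑-concatMap (winTerm 0 k) (insertions a) σs ⟩
    ∑ (λ σ → ∑ (winTerm 0 k) (insertions a σ)) σs               ≡⟨ ∑-cong-local (All.map insert-a (perms-shape (range (suc a) (suc n)) (range-bounded (suc a) (suc n)))) ⟩
    ∑ (λ σ → step n k (λ i → winTerm 0 i σ)) σs                 ≡⟨ ∑-step n k (λ σ i → winTerm 0 i σ) σs ⟩
    step n k (λ i → ∑ (winTerm 0 i) σs)                          ≡⟨ step-cong n k (∑-perms-range n (suc a) (trans (sym (ℕP.+-suc a n)) a+1+n≡N) (s≤s z≤n)) ⟩
    step n k (W n)                                               ∎
    where
    open ≡-Reasoning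
    σs = perms (range (suc a) (suc n))
    a≢N : a ≢ N
    a≢N a≡N = ℕP.m+1+n≢m a (trans a+1+n≡N (sym a≡N))
    insert-a : ∀ {σ} → All (suc a ℕ.≤_) σ × length σ ≡ length (range (suc a) (suc n)) →
               ∑ (winTerm 0 k) (insertions a σ) ≡ step n k (λ i → winTerm 0 i σ)
    insert-a {y ∷ ys} (a<y ∷ _ , len) =
      trans (∑-insert-min k y ys 0<a a<y a≢N)
            (cong (λ l → step l k (λ i → winTerm 0 i (y ∷ ys))) (ℕP.suc-injective (trans len (range-length (suc a) (suc n)))))

winWeight≡W : ∀ θ n k → winWeight (suc n) k θ ≡ Recurrence.W θ n k
winWeight≡W θ n k = trans (cong (∑ (winTerm 0 k) ∘ perms) (map-+-upTo 1 (suc n))) (∑-perms-range n 1 refl (s≤s z≤n) k)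
  where open Game θ (suc n)

-- Unimodality

+-cancelʳ-≤ : ∀ {x y} c → x + c ≤ y + c → x ≤ y
+-cancelʳ-≤ {x} {y} c x+c≤y+c = subst₂ _≤_ (minus-c x) (minus-c y) (ℚP.+-monoˡ-≤ (- c) x+c≤y+c)
  where minus-c = λ z → solve 2 (λ z c → z :+ c :+ :- c := z) refl z c

+-cancelʳ-< : ∀ {x y} c → x + c < y + c → x < y
+-cancelʳ-< {x} {y} c x+c<y+c = subst₂ _<_ (minus-c x) (minus-c y) (ℚP.+-monoˡ-< (- c) x+c<y+c)
  where minus-c = λ z → solve 2 (λ z c → z :+ c :+ :- c := z) refl z c

*-pos : ∀ {a b} → 0ℚ < a → 0ℚ < b → 0ℚ < a * b
*-pos {a} {b} a>0 b>0 = ℚP.positive⁻¹ (a * b) {{ℚP.pos*pos⇒pos a {{positive a>0}} b {{positive b>0}}}}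

module _ {a c x y t : ℚ} (a>0 : 0ℚ < a) (c>0 : 0ℚ < c) (ax+c≡ay+ct : a * x + c ≡ a * y + c * t) where

  ≤-of-increment : t ≤ 1ℚ → x ≤ y
  ≤-of-increment t≤1 = ℚP.*-cancelˡ-≤-pos a {{positive a>0}} (+-cancelʳ-≤ c (begin
    a * x + c      ≡⟨ ax+c≡ay+ct ⟩
    a * y + c * t  ≤⟨ ℚP.+-monoʳ-≤ (a * y) (ℚP.*-monoˡ-≤-nonNeg c {{ℚP.pos⇒nonNeg c {{positive c>0}}}} t≤1) ⟩
    a * y + c * 1ℚ ≡⟨ cong (_+_ (a * y)) (ℚP.*-identityʳ c) ⟩
    a * y + c      ∎))
    where open ℚP.≤-Reasoning

  <-of-increment : t < 1ℚ → x < y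
  <-of-increment t<1 = ℚP.*-cancelˡ-<-nonNeg a {{ℚP.pos⇒nonNeg a {{positive a>0}}}} (+-cancelʳ-< c (begin-strict
    a * x + c      ≡⟨ ax+c≡ay+ct ⟩
    a * y + c * t  <⟨ ℚP.+-monoʳ-< (a * y) (ℚP.*-monoʳ-<-pos c {{positive c>0}} t<1) ⟩
    a * y + c * 1ℚ ≡⟨ cong (_+_ (a * y)) (ℚP.*-identityʳ c) ⟩
    a * y + c      ∎))
    where open ℚP.≤-Reasoning

  >-of-increment : 1ℚ < t → y < x
  >-of-increment 1<t = ℚP.*-cancelˡ-<-nonNeg a {{ℚP.pos⇒nonNeg a {{positive a>0}}}} (+-cancelʳ-< c (begin-strict
    a * y + c      ≡⟨ cong (_+_ (a * y)) (ℚP.*-identityʳ c) ⟨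
    a * y + c * 1ℚ <⟨ ℚP.+-monoʳ-< (a * y) (ℚP.*-monoʳ-<-pos c {{positive c>0}} 1<t) ⟩
    a * y + c * t  ≡⟨ ax+c≡ay+ct ⟨
    a * x + c      ∎))
    where open ℚP.≤-Reasoning

chain : ∀ (_∼_ : ℚ → ℚ → Set) → (∀ {p q r} → p ∼ q → q ∼ r → p ∼ r) → (f : ℕ → ℚ) → ∀ {a b} →
  (∀ i → a ℕ.≤ i → i ℕ.< b → f i ∼ f (suc i)) → a ℕ.< b → f a ∼ f b
chain _∼_ ∼-trans f {a} {suc b} step a<1+b with ℕP.m≤n⇒m<n∨m≡n (ℕP.≤-pred a<1+b)
... | inj₁ a<b  = ∼-trans (chain _∼_ ∼-trans f (λ i a≤i i<b → step i a≤i (ℕP.m≤n⇒m≤1+n i<b)) a<b) (step b (ℕP.<⇒≤ a<b) ℕP.≤-refl)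
... | inj₂ refl = step a ℕP.≤-refl ℕP.≤-refl

module _ (f : ℕ → ℚ) (k n : ℕ)
         (ascending : ∀ i → i ℕ.< k → f i < f (suc i))
         (descending : ∀ i → k ℕ.≤ i → i ℕ.< n → f (suc i) ≤ f i)
         (strictlyDescending : ∀ i → k ℕ.< i → i ℕ.< n → f (suc i) < f i) where

  unimodal-max : ∀ j → j ℕ.≤ n → f j ≤ f k
  unimodal-max j j≤n with ℕP.<-cmp j k
  ... | tri< j<k _ _ = ℚP.<⇒≤ (chain _<_ ℚP.<-trans f (λ i _ i<k → ascending i i<k) j<k)
  ... | tri≈ _ refl _ = ℚP.≤-refl
  ... | tri> _ _ k<j = chain (flip _≤_) (flip ℚP.≤-trans) f (λ i k≤i i<j → descending i k≤i (ℕP.<-≤-trans i<j j≤n)) k<j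

  unimodal-tie : ∀ j → j ℕ.≤ n → j ≢ k → f j ≡ f k → j ≡ suc k
  unimodal-tie j j≤n j≢k fj≡fk with ℕP.<-cmp j k
  ... | tri< j<k _ _ = ⊥-elim (ℚP.<-irrefl fj≡fk (chain _<_ ℚP.<-trans f (λ i _ i<k → ascending i i<k) j<k))
  ... | tri≈ _ j≡k _ = ⊥-elim (j≢k j≡k)
  ... | tri> _ _ k<j with ℕP.m≤n⇒m<n∨m≡n k<j
  ...   | inj₂ 1+k≡j = sym 1+k≡j
  ...   | inj₁ 1+k<j = ⊥-elim (ℚP.<-irrefl fj≡fk (ℚP.<-≤-trans
          (chain (flip _<_) (flip ℚP.<-trans) f (λ i k<i i<j → strictlyDescending i k<i (ℕP.<-≤-trans i<j j≤n)) 1+k<j)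
          (descending k ℕP.≤-refl (ℕP.<-≤-trans k<j j≤n))))

-- The optimal number of rejections

harm-step : ∀ a n → harm (suc a) n ≤ harm a n
harm-step a n with ℕP.≤-<-connex a n
... | inj₁ a≤n = begin
  harm (suc a) n          ≡⟨ ℚP.+-identityˡ _ ⟨
  0ℚ + harm (suc a) n     ≤⟨ ℚP.+-monoˡ-≤ (harm (suc a) n) (inv-nonNeg a) ⟩
  inv a + harm (suc a) n  ≡⟨ harm-cons a n a≤n ⟨
  harm a n                ∎
  where open ℚP.≤-Reasoning
... | inj₂ n<a = ℚP.≤-reflexive (trans (harm-empty (suc a) n (ℕP.m≤n⇒m≤1+n n<a)) (sym (harm-empty a n n<a)))

harm-antitone : ∀ {a b} n → a ℕ.≤ b → harm b n ≤ harm a n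
harm-antitone {a} {b} n a≤b with ℕP.m≤n⇒m<n∨m≡n a≤b
... | inj₁ a<b  = chain (flip _≤_) (flip ℚP.≤-trans) (λ i → harm i n) (λ i _ _ → harm-step i n) a<b
... | inj₂ refl = ℚP.≤-refl

harm-strict : ∀ a n → suc a ℕ.≤ n → harm (suc (suc a)) n < harm (suc a) n
harm-strict a n a<n = begin-strict
  harm (suc (suc a)) n                ≡⟨ ℚP.+-identityˡ _ ⟨
  0ℚ + harm (suc (suc a)) n           <⟨ ℚP.+-monoˡ-< (harm (suc (suc a)) n) (inv-pos a) ⟩
  inv (suc a) + harm (suc (suc a)) n  ≡⟨ harm-cons (suc a) n a<n ⟨
  harm (suc a) n                      ∎
  where open ℚP.≤-Reasoning

rising-pos : ∀ {θ} → 0ℚ < θ → ∀ k → 0ℚ < rising θ k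
rising-pos θ>0 zero    = ℚP.positive⁻¹ 1ℚ
rising-pos θ>0 (suc k) = *-pos (ℚP.+-mono-<-≤ θ>0 (fromℕ-nonNeg k)) (rising-pos θ>0 k)

module Optimum {θ : ℚ} (θ>0 : 0ℚ < θ) (n : ℕ) where
  open Recurrence θ

  threshold : ℕ → ℚ
  threshold i = θ * harm (suc i) n

  θ*-mono : ∀ {p q} → p ≤ q → θ * p ≤ θ * q
  θ*-mono = ℚP.*-monoˡ-≤-nonNeg θ {{ℚP.pos⇒nonNeg θ {{positive θ>0}}}}

  threshold-antitone : ∀ {i j} → i ℕ.≤ j → threshold j ≤ threshold i
  threshold-antitone i≤j = θ*-mono (harm-antitone n (s≤s i≤j))

  thresholds-above : ∀ a → 1ℚ < θ * harm a n → ∀ i → i ℕ.< a → 1ℚ < threshold i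
  thresholds-above a 1<θHa i i<a = ℚP.<-≤-trans 1<θHa (θ*-mono (harm-antitone n i<a))

  last-threshold : threshold n ≡ 0ℚ
  last-threshold = trans (cong (θ *_) (harm-empty (suc n) n ℕP.≤-refl)) (ℚP.*-zeroʳ θ)

  module _ {i : ℕ} (i<n : i ℕ.< n) where
    i!>0 : 0ℚ < fromℕ (i !)
    i!>0 = fromℕ-pos (i !) (ℕP.1≤n! i)
    weight>0 : 0ℚ < incrementFactor n i
    weight>0 = *-pos (*-pos θ>0 (rising-pos θ>0 i)) (fromℕ-pos (n !) (ℕP.1≤n! n))

    W-ascends : 1ℚ < threshold i → W n i < W n (suc i)
    W-ascends = >-of-increment i!>0 weight>0 (W-increment n i i<n)

    W-descends : threshold i ≤ 1ℚ → W n (suc i) ≤ W n i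
    W-descends = ≤-of-increment i!>0 weight>0 (W-increment n i i<n)

    W-strictlyDescends : threshold i < 1ℚ → W n (suc i) < W n i
    W-strictlyDescends = <-of-increment i!>0 weight>0 (W-increment n i i<n)

  optimal : ∀ k → k ℕ.≤ n → (∀ i → i ℕ.< k → 1ℚ < threshold i) → threshold k ≤ 1ℚ →
    (∀ j → j ℕ.≤ n → W n j ≤ W n k) × (∀ j → j ℕ.≤ n → j ≢ k → W n j ≡ W n k → j ≡ suc k × threshold k ≡ 1ℚ)
  optimal k k≤n above below = unimodal-max (W n) k n ascending descending strictlyDescending , tie
    where
    ascending : ∀ i → i ℕ.< k → W n i < W n (suc i)
    ascending i i<k = W-ascends (ℕP.<-≤-trans i<k k≤n) (above i i<k)
    descending : ∀ i → k ℕ.≤ i → i ℕ.< n → W n (suc i) ≤ W n i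
    descending i k≤i i<n = W-descends i<n (ℚP.≤-trans (threshold-antitone k≤i) below)
    strictlyDescending : ∀ i → k ℕ.< i → i ℕ.< n → W n (suc i) < W n i
    strictlyDescending i k<i i<n = W-strictlyDescends i<n (begin-strict
      threshold i                   ≤⟨ threshold-antitone k<i ⟩
      θ * harm (suc (suc k)) n      <⟨ ℚP.*-monoʳ-<-pos θ {{positive θ>0}} (harm-strict k n (ℕP.<-trans k<i i<n)) ⟩
      threshold k                   ≤⟨ below ⟩
      1ℚ                            ∎)
      where open ℚP.≤-Reasoning
    tie : ∀ j → j ℕ.≤ n → j ≢ k → W n j ≡ W n k → j ≡ suc k × threshold k ≡ 1ℚ
    tie j j≤n j≢k Wj≡Wk = j≡1+k , ℚP.≤-antisym below (ℚP.≮⇒≥ (λ t<1 → ℚP.<-irrefl W1+k≡Wk (W-strictlyDescends k<n t<1)))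
      where
      j≡1+k = unimodal-tie (W n) k n ascending descending strictlyDescending j j≤n j≢k Wj≡Wk
      k<n : k ℕ.< n
      k<n = subst (ℕ._≤ n) j≡1+k j≤n
      W1+k≡Wk : W n (suc k) ≡ W n k
      W1+k≡Wk = subst (λ i → W n i ≡ W n k) j≡1+k Wj≡Wk

thresholds-of-interval : ∀ {θ} (θ>0 : 0ℚ < θ) m k →
  ((k ≡ 0 × θ * harm 1 (suc m) ≤ 1ℚ)
   ⊎ ((1 ℕ.≤ k × k ℕ.≤ m) × (1ℚ < θ * harm k (suc m) × θ * harm (suc k) (suc m) ≤ 1ℚ))
   ⊎ (k ≡ suc m × (+ suc m) / 1 < θ))
  → k ℕ.≤ suc m × (∀ i → i ℕ.< k → 1ℚ < θ * harm (suc i) (suc m)) × θ * harm (suc k) (suc m) ≤ 1ℚ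
thresholds-of-interval θ>0 m k (inj₁ (refl , t≤1)) = z≤n , (λ _ ()) , t≤1
thresholds-of-interval θ>0 m k (inj₂ (inj₁ ((_ , k≤m) , 1<θHk , t≤1))) =
  ℕP.m≤n⇒m≤1+n k≤m , Optimum.thresholds-above θ>0 (suc m) k 1<θHk , t≤1
thresholds-of-interval {θ} θ>0 m k (inj₂ (inj₂ (refl , m+1<θ))) =
  ℕP.≤-refl , Optimum.thresholds-above θ>0 (suc m) (suc m) 1<θHₘ₊₁ , subst (_≤ 1ℚ) (sym (Optimum.last-threshold θ>0 (suc m))) (ℚP.nonNegative⁻¹ 1ℚ)
  where
  open ℚP.≤-Reasoning
  1<θHₘ₊₁ : 1ℚ < θ * harm (suc m) (suc m)
  1<θHₘ₊₁ = begin-strict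
    1ℚ                           ≡⟨ fromℕ*inv m ⟨
    fromℕ (suc m) * inv (suc m)  <⟨ ℚP.*-monoˡ-<-pos (inv (suc m)) {{positive (inv-pos m)}} (subst (_< θ) (sym (fromℕ-def (suc m))) m+1<θ) ⟩
    θ * inv (suc m)              ≡⟨ cong (θ *_) (harm-singleton (suc m)) ⟨
    θ * harm (suc m) (suc m)     ∎

corollary4p6 : (N : ℕ) → 2 ℕ.≤ N → (θ : ℚ) → 0ℚ < θ → (k : ℕ)
    → ((k ≡ 0 × θ * harm 1 (N ∸ 1) ≤ 1ℚ)
       ⊎ ((1 ℕ.≤ k × k ℕ.≤ N ∸ 2) × (1ℚ < θ * harm k (N ∸ 1) × θ * harm (suc k) (N ∸ 1) ≤ 1ℚ))
       ⊎ (k ≡ N ∸ 1 × (+ (N ∸ 1)) / 1 < θ))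
    → ((k' : ℕ) → k' ℕ.< N → winWeight N k' θ ≤ winWeight N k θ)
      × ((k' : ℕ) → k' ℕ.< N → k' ≢ k → winWeight N k' θ ≡ winWeight N k θ
           → k' ≡ suc k × θ * harm (suc k) (N ∸ 1) ≡ 1ℚ)
corollary4p6 (suc (suc m)) (s≤s (s≤s z≤n)) θ θ>0 k interval
  with thresholds-of-interval θ>0 m k interval
... | k≤n , above , below =
    (λ j j<N → subst₂ _≤_ (sym (winWeight≡W θ n j)) (sym (winWeight≡W θ n k)) (max j (ℕP.≤-pred j<N)))
  , (λ j j<N j≢k Wj≡Wk → tie j (ℕP.≤-pred j<N) j≢k (trans (sym (winWeight≡W θ n j)) (trans Wj≡Wk (winWeight≡W θ n k))))
  where
  n = suc m
  open Optimum θ>0 n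
  max = proj₁ (optimal k k≤n above below)
  tie = proj₂ (optimal k k≤n above below)
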